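{- Let $T$ be a monad on $\mathbf{Set}$, $\mathcal{D}$ a complete category, $V\colon\mathcal{D}\to\mathbf{Set}$ a faithful functor preserving small limits, $\bar\Omega=(\Omega_{\mathcal{D}},\bar\tau)$ a $\mathcal{D}$-relative $T$-algebra and $(\Omega,\hat\tau)=\bar V(\bar\Omega)$ its underlying $T$-algebra (so $\Omega=V\Omega_{\mathcal{D}}$). Let $\mathbb{P}^{\bar\tau}\colon\mathcal{K}\ell(T)\to\mathcal{D}^{\mathrm{op}}$ be given by $X\mapsto\Omega_{\mathcal{D}}^X$ and $(f\colon X\to TY)\mapsto f^*\circ\bar\tau^\sharp_Y$, and $\mathbb{P}^\tau\colon\mathcal{K}\ell(T)\to\mathbf{Set}^{\mathrm{op}}$ by $X\mapsto\Omega^X$ and $\mathbb{P}^\tau(f)(h)=\hat\tau\circ Th\circ f$ for $h\colon Y\to\Omega$. Then $\mathbb{P}^\tau\cong V^{\mathrm{op}}\circ\mathbb{P}^{\bar\tau}$.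
   Context: For $A\in\mathcal{D}$ and a set $X$, $A^X$ is the $X$-fold product with projections $\pi_x$; for $g\colon X\to Y$, $g^*\colon A^Y\to A^X$ satisfies $\pi_x\circ g^*=\pi_{g(x)}$. The monad $\mathcal{D}(A^{(-)},A)$ on $\mathbf{Set}$: on $g$ it sends $k$ to $k\circ g^*$; unit $\eta_X(x)=\pi_x$; multiplication $\mu_X(\Xi)=\Xi\circ\langle\varphi\rangle_{\varphi\in\mathcal{D}(A^X,A)}$. A $\mathcal{D}$-relative $T$-algebra is $(A,\alpha)$ with $\alpha\colon T\to\mathcal{D}(A^{(-)},A)$ a monad map; $\alpha^\sharp_X=\langle\alpha_X(t)\rangle_{t\in TX}\colon A^X\to A^{TX}$. $\bar V$ sends $(B,\beta)$ to the $T$-algebra on $VB$ with structure $t\mapsto V(\beta_{VB}(t))(\mathrm{id}_{VB})$, using $V(B^{VB})\cong(VB)^{VB}$. -}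

module Defs where

open import Level using (Level; _⊔_) renaming (zero to lzero; suc to lsuc)
open import Data.Unit using (⊤; tt)
open import Data.Product using (Σ; _,_; proj₁; proj₂)
open import Relation.Binary.PropositionalEquality using (_≡_; refl; sym; trans; cong)
open import Relation.Binary.PropositionalEquality.Properties using (trans-reflʳ; trans-assoc)

-- Locally small categories (hom-sets are types in Set, equality ≡).
-- A *small* category is a Category lzero (objects also in Set).

record Category (o : Level) : Set (lsuc o) where
  infixr 9 _∘_
  field
    Obj : Set o
    Hom : Obj → Obj → Set
    idC : ∀ {A} → Hom A A
    _∘_ : ∀ {A B C} → Hom B C → Hom A B → Hom A C
    identityˡ : ∀ {A B} (f : Hom A B) → idC ∘ f ≡ f
    identityʳ : ∀ {A B} (f : Hom A B) → f ∘ idC ≡ f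
    assoc : ∀ {A B C E} (f : Hom A B) (g : Hom B C) (h : Hom C E) →
            (h ∘ g) ∘ f ≡ h ∘ (g ∘ f)

open Category

record Diagram {o : Level} (J : Category lzero) (D : Category o) : Set o where
  field
    F₀ : Obj J → Obj D
    F₁ : ∀ {i j} → Hom J i j → Hom D (F₀ i) (F₀ j)
    F-id : ∀ {i} → F₁ (idC J {i}) ≡ idC D
    F-∘ : ∀ {i j k} (p : Hom J i j) (q : Hom J j k) →
          F₁ (_∘_ J q p) ≡ _∘_ D (F₁ q) (F₁ p)

open Diagram

record Cone {o : Level} {J : Category lzero} {D : Category o} (F : Diagram J D) : Set o where
  field
    apex : Obj D
    leg : ∀ j → Hom D apex (F₀ F j)
    commute : ∀ {i j} (p : Hom J i j) → _∘_ D (F₁ F p) (leg i) ≡ leg j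

open Cone

record IsLimit {o : Level} {J : Category lzero} {D : Category o} (F : Diagram J D)
               (L : Cone F) : Set o where
  field
    mediate : (C : Cone F) → Hom D (apex C) (apex L)
    factor : (C : Cone F) (j : Obj J) → _∘_ D (leg L j) (mediate C) ≡ leg C j
    unique : (C : Cone F) (u : Hom D (apex C) (apex L)) →
             (∀ j → _∘_ D (leg L j) u ≡ leg C j) → u ≡ mediate C

open IsLimit

Limit : {o : Level} {J : Category lzero} {D : Category o} → Diagram J D → Set o
Limit F = Σ (Cone F) (IsLimit F)

Complete : {o : Level} → Category o → Set (lsuc lzero ⊔ o)
Complete D = (J : Category lzero) (F : Diagram J D) → Limit F

record SetFunctor {o : Level} (D : Category o) : Set (lsuc lzero ⊔ o) where
  field
    V₀ : Obj D → Set
    V₁ : ∀ {A B} → Hom D A B → V₀ A → V₀ B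
    V-id : ∀ {A} (x : V₀ A) → V₁ (idC D {A}) x ≡ x
    V-∘ : ∀ {A B C} (f : Hom D A B) (g : Hom D B C) (x : V₀ A) →
          V₁ (_∘_ D g f) x ≡ V₁ g (V₁ f x)

open SetFunctor

Faithful : {o : Level} (D : Category o) → SetFunctor D → Set o
Faithful D V = ∀ {A B} (f g : Hom D A B) → (∀ x → V₁ V f x ≡ V₁ V g x) → f ≡ g

record SetCone (J : Category lzero) (G₀ : Obj J → Set)
               (G₁ : ∀ {i j} → Hom J i j → G₀ i → G₀ j) : Set₁ where
  field
    sapex : Set
    sleg : ∀ j → sapex → G₀ j
    scommute : ∀ {i j} (p : Hom J i j) (x : sapex) → G₁ p (sleg i x) ≡ sleg j x

open SetCone

record IsSetLimit (J : Category lzero) (G₀ : Obj J → Set)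
                  (G₁ : ∀ {i j} → Hom J i j → G₀ i → G₀ j)
                  (L : SetCone J G₀ G₁) : Set₁ where
  field
    smediate : (C : SetCone J G₀ G₁) → sapex C → sapex L
    sfactor : (C : SetCone J G₀ G₁) (j : Obj J) (x : sapex C) →
              sleg L j (smediate C x) ≡ sleg C j x
    sunique : (C : SetCone J G₀ G₁) (u : sapex C → sapex L) →
              (∀ j x → sleg L j (u x) ≡ sleg C j x) → ∀ x → u x ≡ smediate C x

open IsSetLimit

mapCone : {o : Level} {J : Category lzero} {D : Category o} (V : SetFunctor D)
          (F : Diagram J D) → Cone F →
          SetCone J (λ j → V₀ V (F₀ F j)) (λ p → V₁ V (F₁ F p))
mapCone {D = D} V F L = record
  { sapex = V₀ V (apex L)
  ; sleg = λ j → V₁ V (leg L j)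
  ; scommute = λ p x → trans (sym (V-∘ V (leg L _) (F₁ F p) x)) (cong (λ k → V₁ V k x) (commute L p))
  }

PreservesLimits : {o : Level} (D : Category o) → SetFunctor D → Set (lsuc lzero ⊔ o)
PreservesLimits D V = (J : Category lzero) (F : Diagram J D) (L : Cone F) → IsLimit F L →
  IsSetLimit J (λ j → V₀ V (F₀ F j)) (λ p → V₁ V (F₁ F p)) (mapCone V F L)

record SetMonad : Set₁ where
  field
    T : Set → Set
    fmap : ∀ {X Y} → (X → Y) → T X → T Y
    fmap-cong : ∀ {X Y} (f g : X → Y) → (∀ x → f x ≡ g x) → ∀ t → fmap f t ≡ fmap g t
    fmap-id : ∀ {X} (t : T X) → fmap (λ x → x) t ≡ t
    fmap-∘ : ∀ {X Y Z} (f : X → Y) (g : Y → Z) (t : T X) →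
             fmap (λ x → g (f x)) t ≡ fmap g (fmap f t)
    η : ∀ {X} → X → T X
    μ : ∀ {X} → T (T X) → T X
    η-natural : ∀ {X Y} (f : X → Y) (x : X) → fmap f (η x) ≡ η (f x)
    μ-natural : ∀ {X Y} (f : X → Y) (t : T (T X)) → fmap f (μ t) ≡ μ (fmap (fmap f) t)
    unitˡ : ∀ {X} (t : T X) → μ (η t) ≡ t
    unitʳ : ∀ {X} (t : T X) → μ (fmap η t) ≡ t
    μ-assoc : ∀ {X} (t : T (T (T X))) → μ (μ t) ≡ μ (fmap μ t)

open SetMonad

-- X-fold powers A^X in a complete category, obtained as the (chosen)
-- limit of the constant diagram on the discrete category X.

Disc : Set → Category lzero
Disc X = record
  { Obj = X
  ; Hom = λ x y → x ≡ y
  ; idC = refl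
  ; _∘_ = λ q p → trans p q
  ; identityˡ = λ p → trans-reflʳ p
  ; identityʳ = λ p → refl
  ; assoc = λ f g h → sym (trans-assoc f)
  }

ConstD : {o : Level} (D : Category o) → Obj D → (X : Set) → Diagram (Disc X) D
ConstD D A X = record
  { F₀ = λ _ → A
  ; F₁ = λ _ → idC D
  ; F-id = refl
  ; F-∘ = λ p q → sym (identityˡ D (idC D))
  }

module Powers {o : Level} (D : Category o) (lim : Complete D) where

  powLim : (A : Obj D) (X : Set) → Limit (ConstD D A X)
  powLim A X = lim (Disc X) (ConstD D A X)

  pow : Obj D → Set → Obj D
  pow A X = apex (proj₁ (powLim A X))

  π : (A : Obj D) (X : Set) → X → Hom D (pow A X) A
  π A X x = leg (proj₁ (powLim A X)) x

  famCommute : {A C : Obj D} {X : Set} (f : X → Hom D C A) {x y : X} (p : x ≡ y) →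
               _∘_ D (idC D) (f x) ≡ f y
  famCommute f refl = identityˡ D (f _)

  famCone : (A : Obj D) (X : Set) {C : Obj D} → (X → Hom D C A) → Cone (ConstD D A X)
  famCone A X {C} f = record { apex = C ; leg = f ; commute = famCommute f }

  tuple : (A : Obj D) (X : Set) {C : Obj D} → (X → Hom D C A) → Hom D C (pow A X)
  tuple A X f = mediate (proj₂ (powLim A X)) (famCone A X f)

  _* : {A : Obj D} {X Y : Set} → (X → Y) → Hom D (pow A Y) (pow A X)
  _* {A} {X} {Y} g = tuple A X (λ x → π A Y (g x))

  S : Obj D → Set → Set
  S A X = Hom D (pow A X) A

  S-map : {A : Obj D} {X Y : Set} → (X → Y) → S A X → S A Y
  S-map g k = _∘_ D k (g *)

  S-η : {A : Obj D} {X : Set} → X → S A X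
  S-η {A} {X} x = π A X x

  S-μ : {A : Obj D} {X : Set} → S A (S A X) → S A X
  S-μ {A} {X} Ξ = _∘_ D Ξ (tuple A (S A X) (λ φ → φ))

  -- D-relative T-algebras: monad maps T → D(A^(-), A)
  record RelAlg (M : SetMonad) (A : Obj D) : Set (lsuc lzero ⊔ o) where
    field
      α : ∀ X → T M X → S A X
      α-natural : ∀ {X Y} (g : X → Y) (t : T M X) → α Y (fmap M g t) ≡ S-map g (α X t)
      α-unit : ∀ {X} (x : X) → α X (η M x) ≡ S-η x
      α-mult : ∀ {X} (t : T M (T M X)) →
               α X (μ M t) ≡ S-μ (α (S A X) (fmap M (α X) t))

  open RelAlg public

  sharp : {M : SetMonad} {A : Obj D} → RelAlg M A → (X : Set) → Hom D (pow A X) (pow A (T M X))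
  sharp {M} {A} a X = tuple A (T M X) (λ t → α a X t)

  module Underlying (V : SetFunctor D) (pres : PreservesLimits D V) where

    powSetLim : (A : Obj D) (X : Set) →
      IsSetLimit (Disc X) (λ _ → V₀ V A) (λ _ → V₁ V (idC D))
                 (mapCone V (ConstD D A X) (proj₁ (powLim A X)))
    powSetLim A X = pres (Disc X) (ConstD D A X) (proj₁ (powLim A X)) (proj₂ (powLim A X))

    eltCommute : {A : Obj D} {X : Set} (h : X → V₀ V A) {x y : X} (p : x ≡ y) (u : ⊤) →
                 V₁ V (idC D) (h x) ≡ h y
    eltCommute {A} h refl u = V-id V (h _)

    -- the inverse of the canonical bijection V(A^X) → (VA)^X, x ↦ (V π_x)(x)
    elt : (A : Obj D) (X : Set) → (X → V₀ V A) → V₀ V (pow A X)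
    elt A X h = smediate (powSetLim A X)
      (record { sapex = ⊤ ; sleg = λ x _ → h x ; scommute = eltCommute h }) tt

    underlying : {M : SetMonad} {A : Obj D} → RelAlg M A → T M (V₀ V A) → V₀ V A
    underlying {M} {A} b t = V₁ V (α b (V₀ V A) t) (elt A (V₀ V A) (λ x → x))

    module _ (M : SetMonad) (ΩD : Obj D) (τ̄ : RelAlg M ΩD) where

      Ω : Set
      Ω = V₀ V ΩD

      τ̂ : T M Ω → Ω
      τ̂ = underlying τ̄

      ℙτ̄ : {X Y : Set} → (X → T M Y) → Hom D (pow ΩD Y) (pow ΩD X)
      ℙτ̄ {X} {Y} f = _∘_ D (f *) (sharp τ̄ Y)

      ℙτ : {X Y : Set} → (X → T M Y) → (Y → Ω) → (X → Ω)
      ℙτ f h x = τ̂ (fmap M h (f x))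

      -- natural isomorphism ℙ^τ ≅ V^op ∘ ℙ^τ̄  (functors Kl(T) → Set^op);
      -- hom-sets of Set compared pointwise
      record KleisliNatIso : Set₁ where
        field
          φ : (X : Set) → (X → Ω) → V₀ V (pow ΩD X)
          φ-cong : (X : Set) (h h′ : X → Ω) → (∀ x → h x ≡ h′ x) → φ X h ≡ φ X h′
          ψ : (X : Set) → V₀ V (pow ΩD X) → (X → Ω)
          ψφ : (X : Set) (h : X → Ω) (x : X) → ψ X (φ X h) x ≡ h x
          φψ : (X : Set) (e : V₀ V (pow ΩD X)) → φ X (ψ X e) ≡ e
          natural : {X Y : Set} (f : X → T M Y) (h : Y → Ω) →
                    φ X (ℙτ f h) ≡ V₁ V (ℙτ̄ f) (φ Y h)

-- Since V preserves the limit A^X, the map e ↦ (V π_x e)_x is a bijection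
-- V(A^X) ≅ (VA)^X, natural in X along the reindexings g*. Under it the
-- projection π_x of ℙ^τ̄(f) is α(f x), and V(α_Y t) applied to the tuple h
-- equals V(α_{VA}(T h t)) applied to the identity tuple by naturality of α,
-- which is the underlying structure map at T h t.
module Submission where

open import Level using (Level)
open import Data.Unit using (⊤; tt)
open import Data.Product using (proj₁; proj₂)
open import Relation.Binary.PropositionalEquality
open import Defs

module PowerElements {o : Level} (D : Category o) (lim : Complete D)
    (V : SetFunctor D) (pres : PreservesLimits D V) where
  open Category D using (Obj; Hom; assoc) renaming (_∘_ to _∙_)
  open Powers D lim
  open Underlying V pres
  open SetFunctor V

  π-tuple : (A : Obj) (X : Set) {C : Obj} (f : X → Hom C A) (x : X) →
            π A X x ∙ tuple A X f ≡ f x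
  π-tuple A X f = IsLimit.factor (proj₂ (powLim A X)) (famCone A X f)

  π-elt : (A : Obj) (X : Set) (h : X → V₀ A) (x : X) → V₁ (π A X x) (elt A X h) ≡ h x
  π-elt A X h x = IsSetLimit.sfactor (powSetLim A X) _ x tt

  pow-ext : (A : Obj) (X : Set) (e e′ : V₀ (pow A X)) →
            (∀ x → V₁ (π A X x) e ≡ V₁ (π A X x) e′) → e ≡ e′
  pow-ext A X e e′ p =
    trans (unique (λ _ → e) (λ x _ → p x) tt) (sym (unique (λ _ → e′) (λ _ _ → refl) tt))
    where
    cone′ : SetCone (Disc X) (λ _ → V₀ A) (λ _ → V₁ (Category.idC D))
    cone′ = record
      { sapex = ⊤
      ; sleg = λ x _ → V₁ (π A X x) e′
      ; scommute = λ p _ →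
          SetCone.scommute (mapCone V (ConstD D A X) (proj₁ (powLim A X))) p e′
      }
    unique = IsSetLimit.sunique (powSetLim A X) cone′

  elt-cong : (A : Obj) (X : Set) (h h′ : X → V₀ A) → (∀ x → h x ≡ h′ x) →
             elt A X h ≡ elt A X h′
  elt-cong A X h h′ p = pow-ext A X _ _ λ x →
    trans (π-elt A X h x) (trans (p x) (sym (π-elt A X h′ x)))

  elt-π : (A : Obj) (X : Set) (e : V₀ (pow A X)) → elt A X (λ x → V₁ (π A X x) e) ≡ e
  elt-π A X e = pow-ext A X _ _ (π-elt A X _)

  *-elt : {A : Obj} {X Y : Set} (g : X → Y) (h : Y → V₀ A) →
          V₁ (_* {A} g) (elt A Y h) ≡ elt A X (λ x → h (g x))
  *-elt {A} {X} {Y} g h = pow-ext A X _ _ λ x → begin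
    V₁ (π A X x) (V₁ (g *) (elt A Y h))   ≡⟨ V-∘ (g *) (π A X x) _ ⟨
    V₁ (π A X x ∙ g *) (elt A Y h)        ≡⟨ cong (λ k → V₁ k (elt A Y h)) (π-tuple A X _ x) ⟩
    V₁ (π A Y (g x)) (elt A Y h)          ≡⟨ π-elt A Y h (g x) ⟩
    h (g x)                               ≡⟨ π-elt A X _ x ⟨
    V₁ (π A X x) (elt A X (λ x → h (g x))) ∎
    where open ≡-Reasoning

  module _ {M : SetMonad} {A : Obj} (a : RelAlg M A) where
    open SetMonad M using (T; fmap)

    π-*-sharp : {X Y : Set} (f : X → T Y) (x : X) →
                π A X x ∙ (f * ∙ sharp a Y) ≡ α a Y (f x)
    π-*-sharp {X} {Y} f x = begin
      π A X x ∙ (f * ∙ sharp a Y)   ≡⟨ assoc (sharp a Y) (f *) (π A X x) ⟨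
      (π A X x ∙ f *) ∙ sharp a Y   ≡⟨ cong (_∙ sharp a Y) (π-tuple A X _ x) ⟩
      π A (T Y) (f x) ∙ sharp a Y   ≡⟨ π-tuple A (T Y) _ (f x) ⟩
      α a Y (f x)                   ∎
      where open ≡-Reasoning

    underlying-fmap : {Y : Set} (h : Y → V₀ A) (t : T Y) →
                      underlying a (fmap h t) ≡ V₁ (α a Y t) (elt A Y h)
    underlying-fmap {Y} h t = begin
      V₁ (α a (V₀ A) (fmap h t)) idElt   ≡⟨ cong (λ k → V₁ k idElt) (α-natural a h t) ⟩
      V₁ (α a Y t ∙ h *) idElt           ≡⟨ V-∘ (h *) (α a Y t) idElt ⟩
      V₁ (α a Y t) (V₁ (h *) idElt)      ≡⟨ cong (V₁ (α a Y t)) (*-elt h (λ z → z)) ⟩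
      V₁ (α a Y t) (elt A Y h)           ∎
      where
      open ≡-Reasoning
      idElt = elt A (V₀ A) (λ z → z)

proposition4p15 : {o : Level} (M : SetMonad) (D : Category o) (lim : Complete D)
    (V : SetFunctor D) → Faithful D V → (pres : PreservesLimits D V) →
    (ΩD : Category.Obj D) (τ̄ : Powers.RelAlg D lim M ΩD) →
    Powers.Underlying.KleisliNatIso D lim V pres M ΩD τ̄
proposition4p15 M D lim V _ pres ΩD τ̄ = record
  { φ = elt ΩD
  ; φ-cong = elt-cong ΩD
  ; ψ = λ X e x → V₁ (π ΩD X x) e
  ; ψφ = π-elt ΩD
  ; φψ = elt-π ΩD
  ; natural = λ {X} f h → pow-ext ΩD X _ _ λ x → begin
      V₁ (π ΩD X x) (elt ΩD X (ℙτ M ΩD τ̄ f h))        ≡⟨ π-elt ΩD X _ x ⟩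
      underlying τ̄ (fmap h (f x))                     ≡⟨ underlying-fmap τ̄ h (f x) ⟩
      V₁ (α τ̄ _ (f x)) (elt ΩD _ h)                   ≡⟨ cong (λ k → V₁ k (elt ΩD _ h)) (π-*-sharp τ̄ f x) ⟨
      V₁ (π ΩD X x ∙ ℙτ̄ M ΩD τ̄ f) (elt ΩD _ h)         ≡⟨ V-∘ (ℙτ̄ M ΩD τ̄ f) (π ΩD X x) _ ⟩
      V₁ (π ΩD X x) (V₁ (ℙτ̄ M ΩD τ̄ f) (elt ΩD _ h))   ∎
  }
  where
  open Category D using () renaming (_∘_ to _∙_)
  open Powers D lim
  open Underlying V pres
  open SetFunctor V
  open SetMonad M using (fmap)
  open PowerElements D lim V pres
  open ≡-Reasoning
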